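{- Let $r,s\ge 0$ be integers with $n=2(r+s)\ge2$, and let $S\subseteq\mathbb{Z}_4^n$ be the set of vectors of type $(r,s,r,s)$. For $\mathbf{v}\in\mathbb{Z}_4^n$ of type $(t_0,t_1,t_2,t_3)$ let $S(\mathbf{v},0)=\{\mathbf{b}\in S:\ \mathbf{b}\cdot\mathbf{v}=0\}$. Then $$|S(\mathbf{v},0)|=\frac{\binom{n}{r,s,r,s}}{4\binom{n}{t_0,t_1,t_2,t_3}}\Big((x+y+z+w)^n+2\big((x+z)^2-(y+w)^2\big)^r\big((x-z)^2+(y-w)^2\big)^s+(x+y+z+w)^{2r}(x-y+z-w)^{2s}\Big)[t_0,t_1,t_2,t_3].$$
   Context: For $\mathbf{v}\in\mathbb{Z}_4^n$, its type is $(t_0,t_1,t_2,t_3)$ where $t_k$ is the number of coordinates of $\mathbf{v}$ equal to $k$. $\mathbf{b}\cdot\mathbf{v}=\sum_k b_kv_k\in\mathbb{Z}_4$. Multinomial coefficients: $\binom{n}{a,b,c,d}=\frac{n!}{a!b!c!d!}$. For a polynomial $f(x,y,z,w)$, $f[t_0,t_1,t_2,t_3]$ denotes the coefficient of $x^{t_0}y^{t_1}z^{t_2}w^{t_3}$. -}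

module Defs where

open import Data.Nat as ℕ using (ℕ; zero; suc; _!; _%_)
open import Data.Nat.Properties using (_!≢0; m*n≢0)
import Data.Nat.DivMod
open import Data.Integer as ℤ using (ℤ)
open import Data.Fin using (Fin; toℕ)
open import Data.Vec using (Vec; []; _∷_; count; zipWith; foldr)
open import Data.List as List using (List; []; _∷_; concatMap; map; filter; length; _++_)
open import Data.Product using (_×_; _,_)
open import Data.Bool using (Bool; true; false; if_then_else_)
open import Relation.Nullary.Decidable using (⌊_⌋; _×-dec_)
open import Relation.Binary.PropositionalEquality using (_≡_)
import Data.Fin as Fin

ℤ₄ : Set
ℤ₄ = Fin 4

allVecs : (n : ℕ) → List (Vec ℤ₄ n)
allVecs zero    = [] ∷ []
allVecs (suc n) = concatMap (λ a → map (a ∷_) (allVecs n)) (List.allFin 4)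

tcount : ∀ {n} → Fin 4 → Vec ℤ₄ n → ℕ
tcount k v = count (Fin._≟ k) v

dot : ∀ {n} → Vec ℤ₄ n → Vec ℤ₄ n → ℕ
dot b v = foldr _ ℕ._+_ 0 (zipWith (λ a c → toℕ a ℕ.* toℕ c) b v) % 4

S0card : ∀ {n} → ℕ → ℕ → Vec ℤ₄ n → ℕ
S0card {n} r s v = length (filter P? (allVecs n))
  where
  P? = λ (b : Vec ℤ₄ n) →
    (tcount Fin.zero b ℕ.≟ r) ×-dec (tcount (Fin.suc Fin.zero) b ℕ.≟ s) ×-dec
    (tcount (Fin.suc (Fin.suc Fin.zero)) b ℕ.≟ r) ×-dec
    (tcount (Fin.suc (Fin.suc (Fin.suc Fin.zero))) b ℕ.≟ s) ×-dec
    (dot b v ℕ.≟ 0)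

multinomial : ℕ → ℕ → ℕ → ℕ → ℕ
multinomial a b c d =
  Data.Nat.DivMod._/_ ((a ℕ.+ b ℕ.+ c ℕ.+ d) !) (a ! ℕ.* b ! ℕ.* c ! ℕ.* d !)
    {{m*n≢0 _ _ {{m*n≢0 _ _ {{m*n≢0 _ _ {{a !≢0}} {{b !≢0}}}} {{c !≢0}}}} {{d !≢0}}}}

-- Polynomials in x,y,z,w with integer coefficients, as finite lists of
-- terms (coefficient, exponents of x,y,z,w). A polynomial is the sum of its terms.

Mono : Set
Mono = ℕ × ℕ × ℕ × ℕ

Poly : Set
Poly = List (ℤ × Mono)

X Y Z W : Poly
X = (ℤ.+ 1 , (1 , 0 , 0 , 0)) ∷ []
Y = (ℤ.+ 1 , (0 , 1 , 0 , 0)) ∷ []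
Z = (ℤ.+ 1 , (0 , 0 , 1 , 0)) ∷ []
W = (ℤ.+ 1 , (0 , 0 , 0 , 1)) ∷ []

constP : ℤ → Poly
constP c = (c , (0 , 0 , 0 , 0)) ∷ []

infixl 6 _+ₚ_ _-ₚ_
infixl 7 _*ₚ_
infixr 8 _^ₚ_

_+ₚ_ : Poly → Poly → Poly
p +ₚ q = p ++ q

-ₚ_ : Poly → Poly
-ₚ p = map (λ { (c , m) → (ℤ.- c , m) }) p

_-ₚ_ : Poly → Poly → Poly
p -ₚ q = p +ₚ (-ₚ q)

mulMono : Mono → Mono → Mono
mulMono (a , b , c , d) (a' , b' , c' , d') = (a ℕ.+ a' , b ℕ.+ b' , c ℕ.+ c' , d ℕ.+ d')

_*ₚ_ : Poly → Poly → Poly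
p *ₚ q = concatMap (λ { (c , m) → map (λ { (c' , m') → (c ℤ.* c' , mulMono m m') }) q }) p

_^ₚ_ : Poly → ℕ → Poly
p ^ₚ zero  = constP (ℤ.+ 1)
p ^ₚ suc k = p *ₚ (p ^ₚ k)

coeff : Poly → ℕ → ℕ → ℕ → ℕ → ℤ
coeff [] t₀ t₁ t₂ t₃ = ℤ.+ 0
coeff ((c , (a , b , e , d)) ∷ p) t₀ t₁ t₂ t₃ =
  (if ⌊ (a ℕ.≟ t₀) ×-dec (b ℕ.≟ t₁) ×-dec (e ℕ.≟ t₂) ×-dec (d ℕ.≟ t₃) ⌋
   then c else ℤ.+ 0) ℤ.+ coeff p t₀ t₁ t₂ t₃

F : ℕ → ℕ → Poly
F r s =
  (X +ₚ Y +ₚ Z +ₚ W) ^ₚ (2 ℕ.* (r ℕ.+ s))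
  +ₚ constP (ℤ.+ 2) *ₚ ((X +ₚ Z) ^ₚ 2 -ₚ (Y +ₚ W) ^ₚ 2) ^ₚ r
                    *ₚ ((X -ₚ Z) ^ₚ 2 +ₚ (Y -ₚ W) ^ₚ 2) ^ₚ s
  +ₚ (X +ₚ Y +ₚ Z +ₚ W) ^ₚ (2 ℕ.* r) *ₚ (X -ₚ Y +ₚ Z -ₚ W) ^ₚ (2 ℕ.* s)

-- For b ∈ ℤ₄ⁿ and c ∈ ℤ₄ let G_c(b) = Σ x^(type w), summed over the words w with w · b = c.
-- Counting the pairs (v′, w) with type v′ = type v, type w = type b and w · v′ = 0 in two ways, and
-- using that the number of words of a given type orthogonal to v depends only on the type of v, gives
-- multinomial(type v) · [x^(type b)] G₀(v) = multinomial(type b) · [x^(type v)] G₀(b).  Taking for b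
-- the word (0 2)ʳ (1 3)ˢ turns |S(v, 0)| into a coefficient of G₀(b).  For a character χ of ℤ₄,
-- prepending a letter β to b multiplies Σ_c χ(c) G_c(b) by Σ_j χ(jβ) x_j, and 4 G₀ = Σ_χ Σ_c χ(c) G_c.
-- For (0 2)ʳ (1 3)ˢ the character sums are (x+y+z+w)ⁿ, (x+y+z+w)^2r (x−y+z−w)^2s, and, for both
-- χ = iᶜ and its conjugate, ((x+z)² − (y+w)²)ʳ ((x−z)² + (y−w)²)ˢ; their sum is F.

module Submission where

open import Algebra.Bundles using (CommutativeSemiring; CommutativeRing)
open import Data.List as List using (List; []; _∷_; _++_; map; concatMap; filter; length)
open import Function using (_∘_; _⇔_; mk⇔)

-- Sums over lists in a commutative semiring

module ListSum {c ℓ} (R : CommutativeSemiring c ℓ) where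

  open CommutativeSemiring R
  open import Algebra.Properties.CommutativeSemigroup +-commutativeSemigroup using (interchange)
  open import Relation.Binary.Reasoning.Setoid setoid

  private
    variable
      A B : Set

  ∑ : List A → (A → Carrier) → Carrier
  ∑ []       f = 0#
  ∑ (x ∷ xs) f = f x + ∑ xs f

  syntax ∑ xs (λ x → e) = ∑[ x ∈ xs ] e

  ∑-cong : ∀ (xs : List A) {f g} → (∀ x → f x ≈ g x) → ∑ xs f ≈ ∑ xs g
  ∑-cong []       f≈g = refl
  ∑-cong (x ∷ xs) f≈g = +-cong (f≈g x) (∑-cong xs f≈g)

  ∑-++ : ∀ (xs ys : List A) f → ∑ (xs ++ ys) f ≈ ∑ xs f + ∑ ys f
  ∑-++ []       ys f = sym (+-identityˡ _)
  ∑-++ (x ∷ xs) ys f = begin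
    f x + ∑ (xs ++ ys) f       ≈⟨ +-congˡ (∑-++ xs ys f) ⟩
    f x + (∑ xs f + ∑ ys f)    ≈⟨ +-assoc _ _ _ ⟨
    f x + ∑ xs f + ∑ ys f      ∎

  ∑-map : ∀ (g : A → B) (xs : List A) f → ∑ (map g xs) f ≈ ∑ xs (f ∘ g)
  ∑-map g []       f = refl
  ∑-map g (x ∷ xs) f = +-congˡ (∑-map g xs f)

  ∑-concatMap : ∀ (g : A → List B) (xs : List A) f →
                ∑ (concatMap g xs) f ≈ ∑[ x ∈ xs ] ∑ (g x) f
  ∑-concatMap g []       f = refl
  ∑-concatMap g (x ∷ xs) f = trans (∑-++ (g x) (concatMap g xs) f) (+-congˡ (∑-concatMap g xs f))

  ∑-zero : ∀ (xs : List A) → ∑[ x ∈ xs ] 0# ≈ 0#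
  ∑-zero []       = refl
  ∑-zero (x ∷ xs) = trans (+-identityˡ _) (∑-zero xs)

  ∑-distrib-+ : ∀ (xs : List A) f g → ∑[ x ∈ xs ] (f x + g x) ≈ ∑ xs f + ∑ xs g
  ∑-distrib-+ []       f g = sym (+-identityˡ 0#)
  ∑-distrib-+ (x ∷ xs) f g =
    trans (+-congˡ (∑-distrib-+ xs f g)) (interchange (f x) (g x) _ _)

  ∑-distribˡ-* : ∀ (xs : List A) c f → ∑[ x ∈ xs ] (c * f x) ≈ c * ∑ xs f
  ∑-distribˡ-* []       c f = sym (zeroʳ c)
  ∑-distribˡ-* (x ∷ xs) c f =
    trans (+-congˡ (∑-distribˡ-* xs c f)) (sym (distribˡ c (f x) _))

  ∑-distribʳ-* : ∀ (xs : List A) c f → ∑[ x ∈ xs ] (f x * c) ≈ ∑ xs f * c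
  ∑-distribʳ-* []       c f = sym (zeroˡ c)
  ∑-distribʳ-* (x ∷ xs) c f =
    trans (+-congˡ (∑-distribʳ-* xs c f)) (sym (distribʳ c (f x) _))

  ∑-comm : ∀ (xs : List A) (ys : List B) (f : A → B → Carrier) →
           ∑[ x ∈ xs ] ∑[ y ∈ ys ] f x y ≈ ∑[ y ∈ ys ] ∑[ x ∈ xs ] f x y
  ∑-comm []       ys f = sym (∑-zero ys)
  ∑-comm (x ∷ xs) ys f =
    trans (+-congˡ (∑-comm xs ys f)) (sym (∑-distrib-+ ys (f x) (λ y → ∑[ x ∈ xs ] f x y)))

-- Imported only now: ListSum opens a semiring, whose _+_, refl, zero, … would clash with these.

open import Defs
open import Algebra.Structures using (IsCommutativeRing)
import Algebra.Solver.Ring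
open import Algebra.Solver.Ring.AlmostCommutativeRing using (fromCommutativeRing; _-Raw-AlmostCommutative⟶_)
open import Data.Bool using (true; false; if_then_else_)
open import Data.Fin as Fin using (zero; suc; toℕ)
open import Data.Fin.Patterns using (0F; 1F; 2F; 3F)
import Data.Fin.Properties as FinP
open import Data.Integer as ℤ using (ℤ; +_) renaming (_*_ to _ℤ*_)
import Data.Integer.Properties as ℤP
open import Data.Integer.Tactic.RingSolver using () renaming (solve-∀ to ℤ-solve-∀)
import Data.List.Properties as ListP
open import Data.Maybe using (Maybe; just; nothing)
open import Data.Nat as ℕ using (ℕ; zero; suc; _+_; _*_; _∸_; _%_; _!; _/_; _<_; _≤_; _≟_; _≤?_; NonZero; s≤s; z≤n)
open import Data.Nat.DivMod using (%-distribˡ-+; m%n%n≡m%n; [m+kn]%n≡m%n; m<n⇒m%n≡m; m*n/n≡m)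
import Data.Nat.Properties as ℕP
open import Algebra.Properties.CommutativeSemigroup ℕP.+-commutativeSemigroup using () renaming (x∙yz≈y∙xz to x+[y+z]≡y+[x+z])
open import Algebra.Properties.CommutativeSemigroup ℕP.*-commutativeSemigroup using () renaming (x∙yz≈y∙xz to x*[y*z]≡y*[x*z])
open import Data.Nat.Properties using (_!≢0; m*n≢0)
open import Data.Nat.Tactic.RingSolver using (solve-∀)
open import Data.Product using (Σ; _×_; _,_)
open import Data.Vec as Vec using (Vec; []; _∷_; count)
open import Relation.Binary.Definitions using (DecidableEquality)
open import Relation.Binary.PropositionalEquality using (_≡_; refl; sym; trans; cong; cong₂; subst; ≡-≟-identity; module ≡-Reasoning)
open import Relation.Binary.Structures using (IsEquivalence)
open import Relation.Nullary using (Dec; does; yes; no)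
open import Relation.Nullary.Decidable using (_×-dec_; isYes≗does; does-⇔)

module ℕΣ = ListSum ℕP.+-*-commutativeSemiring
module ℤΣ = ListSum ℤP.+-*-commutativeSemiring

private
  variable
    A B : Set
    n : ℕ

𝟙 : {P : Set} → Dec P → ℕ
𝟙 P? = if does P? then 1 else 0

𝟙-×-dec : ∀ {P Q : Set} (P? : Dec P) (Q? : Dec Q) → 𝟙 (P? ×-dec Q?) ≡ 𝟙 P? * 𝟙 Q?
𝟙-×-dec P? Q? with does P? | does Q?
... | true  | true  = refl
... | true  | false = refl
... | false | _     = refl

𝟙-*-cong : ∀ {P : Set} (P? : Dec P) {x y} → (P → x ≡ y) → 𝟙 P? * x ≡ 𝟙 P? * y
𝟙-*-cong (yes p) x≡y = cong (1 *_) (x≡y p)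
𝟙-*-cong (no _)  x≡y = refl

swapAt : ℕ → Vec A n → Vec A n
swapAt zero    (x ∷ y ∷ w) = y ∷ x ∷ w
swapAt (suc i) (x ∷ w)     = x ∷ swapAt i w
swapAt _       w           = w

SwapInvariant : (Vec A n → B) → Set
SwapInvariant f = ∀ i w → f (swapAt i w) ≡ f w

module Tally {A : Set} (_≟_ : DecidableEquality A) where

  tally : A → Vec A n → ℕ
  tally k = count (_≟ k)

  infix 4 _∼_
  record _∼_ (u v : Vec A n) : Set where
    constructor sameTally
    field tally-≡ : ∀ k → tally k u ≡ tally k v
  open _∼_ public

  tally-∷ : ∀ k x (w : Vec A n) → tally k (x ∷ w) ≡ 𝟙 (x ≟ k) + tally k w
  tally-∷ k x w with does (x ≟ k)
  ... | true  = refl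
  ... | false = refl

  ∼-trans : {u v w : Vec A n} → u ∼ v → v ∼ w → u ∼ w
  ∼-trans u∼v v∼w = sameTally λ k → trans (tally-≡ u∼v k) (tally-≡ v∼w k)

  ∼-∷ : ∀ x {u v : Vec A n} → u ∼ v → x ∷ u ∼ x ∷ v
  ∼-∷ x {u} {v} u∼v = sameTally λ k →
    trans (tally-∷ k x u) (trans (cong (_+_ (𝟙 (x ≟ k))) (tally-≡ u∼v k)) (sym (tally-∷ k x v)))

  ∼-∷⁻ : ∀ x {u v : Vec A n} → x ∷ u ∼ x ∷ v → u ∼ v
  ∼-∷⁻ x {u} {v} xu∼xv = sameTally λ k →
    ℕP.+-cancelˡ-≡ (𝟙 (x ≟ k)) _ _ (trans (sym (tally-∷ k x u)) (trans (tally-≡ xu∼xv k) (tally-∷ k x v)))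

  ∼-swap : ∀ x y (w : Vec A n) → x ∷ y ∷ w ∼ y ∷ x ∷ w
  ∼-swap x y w = sameTally λ k → begin
    tally k (x ∷ y ∷ w)                 ≡⟨ trans (tally-∷ k x (y ∷ w)) (cong (_+_ (𝟙 (x ≟ k))) (tally-∷ k y w)) ⟩
    𝟙 (x ≟ k) + (𝟙 (y ≟ k) + tally k w) ≡⟨ x+[y+z]≡y+[x+z] (𝟙 (x ≟ k)) (𝟙 (y ≟ k)) (tally k w) ⟩
    𝟙 (y ≟ k) + (𝟙 (x ≟ k) + tally k w) ≡⟨ trans (tally-∷ k y (x ∷ w)) (cong (_+_ (𝟙 (y ≟ k))) (tally-∷ k x w)) ⟨
    tally k (y ∷ x ∷ w)                 ∎
    where open ≡-Reasoning

  swapAt-∼ : ∀ i (w : Vec A n) → swapAt i w ∼ w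
  swapAt-∼ zero    []          = sameTally λ k → refl
  swapAt-∼ zero    (x ∷ [])    = sameTally λ k → refl
  swapAt-∼ zero    (x ∷ y ∷ w) = ∼-swap y x w
  swapAt-∼ (suc i) []          = sameTally λ k → refl
  swapAt-∼ (suc i) (x ∷ w)     = ∼-∷ x (swapAt-∼ i w)

  move-to-front : (f : Vec A (suc n) → B) → SwapInvariant f → ∀ a v → 0 < tally a v →
                Σ (Vec A n) λ u → f v ≡ f (a ∷ u) × v ∼ a ∷ u
  move-to-front f inv a (x ∷ w) a∈xw with x ≟ a
  ... | yes refl = w , refl , sameTally λ k → refl
  move-to-front {n = zero}  f inv a (x ∷ []) () | no _
  move-to-front {n = suc n} f inv a (x ∷ w) a∈w | no _
    with move-to-front (f ∘ (x ∷_)) (λ i → inv (suc i) ∘ (x ∷_)) a w a∈w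
  ... | u , fxw≡fxau , w∼au =
    x ∷ u , trans fxw≡fxau (sym (inv zero (x ∷ a ∷ u))) , ∼-trans (∼-∷ x w∼au) (∼-swap x a u)

  ∼⇒≡ : (f : Vec A n → B) → SwapInvariant f → ∀ {u v} → u ∼ v → f u ≡ f v
  ∼⇒≡ f inv {[]}    {[]} _   = refl
  ∼⇒≡ f inv {a ∷ u} {v}  u∼v with move-to-front f inv a v a∈v
    where
    a∈au : 0 < tally a (a ∷ u)
    a∈au rewrite ≡-≟-identity _≟_ {a} refl = s≤s z≤n
    a∈v : 0 < tally a v
    a∈v = subst (0 <_) (tally-≡ u∼v a) a∈au
  ... | u′ , fv≡fau′ , v∼au′ =
    trans (∼⇒≡ (f ∘ (a ∷_)) (λ i → inv (suc i) ∘ (a ∷_)) (∼-∷⁻ a (∼-trans u∼v v∼au′))) (sym fv≡fau′)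

-- Polynomials in x, y, z, w, identified when all their coefficients agree

module _ where

  open ℤΣ

  infix 4 _≋_ _≋?_ _≤ₘ_ _≤ₘ?_
  infixl 6 _∸ₘ_

  -- Componentwise, so that `does (m ≋? t)` is literally the test made by `coeff` in Defs.
  _≋_ : Mono → Mono → Set
  (a , b , c , d) ≋ (a′ , b′ , c′ , d′) = a ≡ a′ × b ≡ b′ × c ≡ c′ × d ≡ d′

  _≋?_ : (m m′ : Mono) → Dec (m ≋ m′)
  (a , b , c , d) ≋? (a′ , b′ , c′ , d′) = a ≟ a′ ×-dec b ≟ b′ ×-dec c ≟ c′ ×-dec d ≟ d′

  _≤ₘ_ : Mono → Mono → Set
  (a , b , c , d) ≤ₘ (a′ , b′ , c′ , d′) = a ≤ a′ × b ≤ b′ × c ≤ c′ × d ≤ d′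

  _≤ₘ?_ : (m m′ : Mono) → Dec (m ≤ₘ m′)
  (a , b , c , d) ≤ₘ? (a′ , b′ , c′ , d′) = a ≤? a′ ×-dec b ≤? b′ ×-dec c ≤? c′ ×-dec d ≤? d′

  _∸ₘ_ : Mono → Mono → Mono
  (a , b , c , d) ∸ₘ (a′ , b′ , c′ , d′) = a ∸ a′ , b ∸ b′ , c ∸ c′ , d ∸ d′

  mulMono≋⇔ : ∀ m m′ t → mulMono m m′ ≋ t ⇔ (m ≤ₘ t × m′ ≋ t ∸ₘ m)
  mulMono≋⇔ m m′ t = mk⇔
    (λ (e₀ , e₁ , e₂ , e₃) →
       (≤-of e₀ , ≤-of e₁ , ≤-of e₂ , ≤-of e₃) , (∸-of e₀ , ∸-of e₁ , ∸-of e₂ , ∸-of e₃))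
    (λ ((l₀ , l₁ , l₂ , l₃) , (e₀ , e₁ , e₂ , e₃)) → +-of l₀ e₀ , +-of l₁ e₁ , +-of l₂ e₂ , +-of l₃ e₃)
    where
    ≤-of : ∀ {a a′ t} → a + a′ ≡ t → a ≤ t
    ≤-of {a} {a′} refl = ℕP.m≤m+n a a′
    ∸-of : ∀ {a a′ t} → a + a′ ≡ t → a′ ≡ t ∸ a
    ∸-of {a} {a′} refl = sym (ℕP.m+n∸m≡n a a′)
    +-of : ∀ {a a′ t} → a ≤ t → a′ ≡ t ∸ a → a + a′ ≡ t
    +-of a≤t refl = ℕP.m+[n∸m]≡n a≤t

  termCoeff : ℤ × Mono → Mono → ℤ
  termCoeff (c , m) t = if does (m ≋? t) then c else + 0

  coeffAt : Poly → Mono → ℤ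
  coeffAt p t = ∑[ u ∈ p ] termCoeff u t

  coeff≡coeffAt : ∀ p t₀ t₁ t₂ t₃ → coeff p t₀ t₁ t₂ t₃ ≡ coeffAt p (t₀ , t₁ , t₂ , t₃)
  coeff≡coeffAt []            t₀ t₁ t₂ t₃ = refl
  coeff≡coeffAt ((c , m) ∷ p) t₀ t₁ t₂ t₃ = cong₂ ℤ._+_
    (cong (λ b → if b then c else + 0) (isYes≗does (m ≋? (t₀ , t₁ , t₂ , t₃))))
    (coeff≡coeffAt p t₀ t₁ t₂ t₃)

  coeffAt-++ : ∀ p q t → coeffAt (p ++ q) t ≡ coeffAt p t ℤ.+ coeffAt q t
  coeffAt-++ p q t = ∑-++ p q (λ u → termCoeff u t)

  coeffAt-neg : ∀ p t → coeffAt (-ₚ p) t ≡ ℤ.- coeffAt p t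
  coeffAt-neg []            t = refl
  coeffAt-neg ((c , m) ∷ p) t = begin
    termCoeff (ℤ.- c , m) t ℤ.+ coeffAt (-ₚ p) t   ≡⟨ cong₂ ℤ._+_ (neg-if (does (m ≋? t))) (coeffAt-neg p t) ⟩
    ℤ.- termCoeff (c , m) t ℤ.+ ℤ.- coeffAt p t    ≡⟨ ℤP.neg-distrib-+ (termCoeff (c , m) t) _ ⟨
    ℤ.- coeffAt ((c , m) ∷ p) t                     ∎
    where
    open ≡-Reasoning
    neg-if : ∀ b → (if b then ℤ.- c else + 0) ≡ ℤ.- (if b then c else + 0)
    neg-if true  = refl
    neg-if false = refl

  _⊙_ : ℤ × Mono → ℤ × Mono → ℤ × Mono
  (c , m) ⊙ (c′ , m′) = c ℤ.* c′ , mulMono m m′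

  termCoeff-⊙ : ∀ c m u′ t →
    termCoeff ((c , m) ⊙ u′) t ≡ (if does (m ≤ₘ? t) then c ℤ.* termCoeff u′ (t ∸ₘ m) else + 0)
  termCoeff-⊙ c m (c′ , m′) t
    rewrite does-⇔ (mulMono≋⇔ m m′ t) (mulMono m m′ ≋? t) (m ≤ₘ? t ×-dec m′ ≋? t ∸ₘ m)
    with does (m ≤ₘ? t) | does (m′ ≋? t ∸ₘ m)
  ... | true  | true  = refl
  ... | true  | false = sym (ℤP.*-zeroʳ c)
  ... | false | _     = refl

  coeffAt-* : ∀ p q t → coeffAt (p *ₚ q) t ≡ ∑[ u ∈ p ] ∑[ u′ ∈ q ] termCoeff (u ⊙ u′) t
  coeffAt-* p q t = trans (∑-concatMap (λ u → map (u ⊙_) q) p (λ u → termCoeff u t))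
                          (∑-cong p (λ u → ∑-map (u ⊙_) q (λ u → termCoeff u t)))

  coeffAt-*-convolution : ∀ p q t →
    coeffAt (p *ₚ q) t ≡ ∑[ (c , m) ∈ p ] (if does (m ≤ₘ? t) then c ℤ.* coeffAt q (t ∸ₘ m) else + 0)
  coeffAt-*-convolution p q t =
    trans (coeffAt-* p q t) (∑-cong p λ (c , m) →
      trans (∑-cong q (λ u′ → termCoeff-⊙ c m u′ t)) (∑-if (does (m ≤ₘ? t)) c (t ∸ₘ m)))
    where
    ∑-if : ∀ b c s → ∑[ u′ ∈ q ] (if b then c ℤ.* termCoeff u′ s else + 0) ≡ (if b then c ℤ.* coeffAt q s else + 0)
    ∑-if true  c s = ∑-distribˡ-* q c (λ u′ → termCoeff u′ s)
    ∑-if false c s = ∑-zero q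

  infix 4 _≈ₚ_
  record _≈ₚ_ (p q : Poly) : Set where
    constructor coeffwise
    field coeffAt-≡ : ∀ t → coeffAt p t ≡ coeffAt q t
  open _≈ₚ_ public

  ⊙-comm : ∀ u u′ → u ⊙ u′ ≡ u′ ⊙ u
  ⊙-comm (c , a , b , e , d) (c′ , a′ , b′ , e′ , d′) = cong₂ _,_ (ℤP.*-comm c c′)
    (cong₂ _,_ (ℕP.+-comm a a′) (cong₂ _,_ (ℕP.+-comm b b′) (cong₂ _,_ (ℕP.+-comm e e′) (ℕP.+-comm d d′))))

  ⊙-assoc : ∀ u u′ u″ → (u ⊙ u′) ⊙ u″ ≡ u ⊙ (u′ ⊙ u″)
  ⊙-assoc (c , a , b , e , d) (c′ , a′ , b′ , e′ , d′) (c″ , a″ , b″ , e″ , d″) =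
    cong₂ _,_ (ℤP.*-assoc c c′ c″) (cong₂ _,_ (ℕP.+-assoc a a′ a″)
      (cong₂ _,_ (ℕP.+-assoc b b′ b″) (cong₂ _,_ (ℕP.+-assoc e e′ e″) (ℕP.+-assoc d d′ d″))))

  *ₚ-comm : ∀ p q → p *ₚ q ≈ₚ q *ₚ p
  *ₚ-comm p q = coeffwise λ t → begin
    coeffAt (p *ₚ q) t                        ≡⟨ coeffAt-* p q t ⟩
    ∑[ u ∈ p ] ∑[ u′ ∈ q ] termCoeff (u ⊙ u′) t ≡⟨ ∑-comm p q _ ⟩
    ∑[ u′ ∈ q ] ∑[ u ∈ p ] termCoeff (u ⊙ u′) t ≡⟨ ∑-cong q (λ u′ → ∑-cong p (λ u → cong (λ v → termCoeff v t)
                                                     (⊙-comm u u′))) ⟩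
    ∑[ u′ ∈ q ] ∑[ u ∈ p ] termCoeff (u′ ⊙ u) t ≡⟨ coeffAt-* q p t ⟨
    coeffAt (q *ₚ p) t                        ∎
    where open ≡-Reasoning

  *ₚ-assoc : ∀ p q r → (p *ₚ q) *ₚ r ≈ₚ p *ₚ (q *ₚ r)
  *ₚ-assoc p q r = coeffwise λ t → begin
    coeffAt ((p *ₚ q) *ₚ r) t
      ≡⟨ coeffAt-* (p *ₚ q) r t ⟩
    ∑[ v ∈ p *ₚ q ] ∑[ u″ ∈ r ] termCoeff (v ⊙ u″) t
      ≡⟨ ∑-concatMap (λ u → map (u ⊙_) q) p _ ⟩
    ∑[ u ∈ p ] ∑[ v ∈ map (u ⊙_) q ] ∑[ u″ ∈ r ] termCoeff (v ⊙ u″) t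
      ≡⟨ ∑-cong p (λ u → ∑-map (u ⊙_) q _) ⟩
    ∑[ u ∈ p ] ∑[ u′ ∈ q ] ∑[ u″ ∈ r ] termCoeff ((u ⊙ u′) ⊙ u″) t
      ≡⟨ ∑-cong p (λ u → ∑-cong q (λ u′ → ∑-cong r (λ u″ → cong (λ v → termCoeff v t) (⊙-assoc u u′ u″)))) ⟩
    ∑[ u ∈ p ] ∑[ u′ ∈ q ] ∑[ u″ ∈ r ] termCoeff (u ⊙ (u′ ⊙ u″)) t
      ≡⟨ ∑-cong p (λ u → ∑-cong q (λ u′ → ∑-map (u′ ⊙_) r _)) ⟨
    ∑[ u ∈ p ] ∑[ u′ ∈ q ] ∑[ v ∈ map (u′ ⊙_) r ] termCoeff (u ⊙ v) t
      ≡⟨ ∑-cong p (λ u → ∑-concatMap (λ u′ → map (u′ ⊙_) r) q _) ⟨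
    ∑[ u ∈ p ] ∑[ v ∈ q *ₚ r ] termCoeff (u ⊙ v) t
      ≡⟨ coeffAt-* p (q *ₚ r) t ⟨
    coeffAt (p *ₚ (q *ₚ r)) t
      ∎
    where open ≡-Reasoning

  *ₚ-congˡ : ∀ p {q q′} → q ≈ₚ q′ → p *ₚ q ≈ₚ p *ₚ q′
  *ₚ-congˡ p {q} {q′} q≈q′ = coeffwise λ t →
    trans (coeffAt-*-convolution p q t)
          (trans (∑-cong p (λ (c , m) → cong (λ z → if does (m ≤ₘ? t) then c ℤ.* z else + 0) (coeffAt-≡ q≈q′ (t ∸ₘ m))))
                 (sym (coeffAt-*-convolution p q′ t)))

  *ₚ-distribˡ : ∀ p q r → p *ₚ (q +ₚ r) ≈ₚ p *ₚ q +ₚ p *ₚ r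
  *ₚ-distribˡ p q r = coeffwise λ t → begin
    coeffAt (p *ₚ (q ++ r)) t
      ≡⟨ coeffAt-* p (q ++ r) t ⟩
    ∑[ u ∈ p ] ∑[ u′ ∈ q ++ r ] termCoeff (u ⊙ u′) t
      ≡⟨ ∑-cong p (λ u → ∑-++ q r _) ⟩
    ∑[ u ∈ p ] (∑[ u′ ∈ q ] termCoeff (u ⊙ u′) t ℤ.+ ∑[ u′ ∈ r ] termCoeff (u ⊙ u′) t)
      ≡⟨ ∑-distrib-+ p _ _ ⟩
    ∑[ u ∈ p ] ∑[ u′ ∈ q ] termCoeff (u ⊙ u′) t ℤ.+ ∑[ u ∈ p ] ∑[ u′ ∈ r ] termCoeff (u ⊙ u′) t
      ≡⟨ cong₂ ℤ._+_ (coeffAt-* p q t) (coeffAt-* p r t) ⟨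
    coeffAt (p *ₚ q) t ℤ.+ coeffAt (p *ₚ r) t
      ≡⟨ coeffAt-++ (p *ₚ q) (p *ₚ r) t ⟨
    coeffAt (p *ₚ q +ₚ p *ₚ r) t
      ∎
    where open ≡-Reasoning

  *ₚ-distribʳ : ∀ p q r → (q +ₚ r) *ₚ p ≈ₚ q *ₚ p +ₚ r *ₚ p
  *ₚ-distribʳ p q r = coeffwise λ t → begin
    coeffAt ((q ++ r) *ₚ p) t     ≡⟨ cong (λ s → coeffAt s t) (ListP.concatMap-++ (λ u → map (u ⊙_) p) q r) ⟩
    coeffAt (q *ₚ p +ₚ r *ₚ p) t  ∎
    where open ≡-Reasoning

  1ₚ : Poly
  1ₚ = constP (+ 1)

  *ₚ-identityˡ : ∀ p → 1ₚ *ₚ p ≈ₚ p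
  *ₚ-identityˡ p = coeffwise λ t → trans (coeffAt-* 1ₚ p t) (trans (ℤP.+-identityʳ _)
    (∑-cong p (λ (c , m) → cong (λ z → termCoeff (z , m) t) (ℤP.*-identityˡ c))))

  +ₚ-cong : ∀ {p p′ q q′} → p ≈ₚ p′ → q ≈ₚ q′ → p +ₚ q ≈ₚ p′ +ₚ q′
  +ₚ-cong {p} {p′} {q} {q′} p≈p′ q≈q′ = coeffwise λ t →
    trans (coeffAt-++ p q t) (trans (cong₂ ℤ._+_ (coeffAt-≡ p≈p′ t) (coeffAt-≡ q≈q′ t)) (sym (coeffAt-++ p′ q′ t)))

  +ₚ-assoc : ∀ p q r → (p +ₚ q) +ₚ r ≈ₚ p +ₚ (q +ₚ r)
  +ₚ-assoc p q r = coeffwise λ t → cong (λ p → coeffAt p t) (ListP.++-assoc p q r)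

  +ₚ-comm : ∀ p q → p +ₚ q ≈ₚ q +ₚ p
  +ₚ-comm p q = coeffwise λ t →
    trans (coeffAt-++ p q t) (trans (ℤP.+-comm (coeffAt p t) _) (sym (coeffAt-++ q p t)))

  +ₚ-identityʳ : ∀ p → p +ₚ [] ≈ₚ p
  +ₚ-identityʳ p = coeffwise λ t → cong (λ p → coeffAt p t) (ListP.++-identityʳ p)

  -ₚ-inverseˡ : ∀ p → -ₚ p +ₚ p ≈ₚ []
  -ₚ-inverseˡ p = coeffwise λ t →
    trans (coeffAt-++ (-ₚ p) p t) (trans (cong (ℤ._+ coeffAt p t) (coeffAt-neg p t)) (ℤP.+-inverseˡ (coeffAt p t)))

  -ₚ-cong : ∀ {p q} → p ≈ₚ q → -ₚ p ≈ₚ -ₚ q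
  -ₚ-cong {p} {q} p≈q = coeffwise λ t → trans (coeffAt-neg p t) (trans (cong ℤ.-_ (coeffAt-≡ p≈q t)) (sym (coeffAt-neg q t)))

  ≈ₚ-isEquivalence : IsEquivalence _≈ₚ_
  ≈ₚ-isEquivalence = record
    { refl  = coeffwise λ t → refl
    ; sym   = λ p≈q → coeffwise λ t → sym (coeffAt-≡ p≈q t)
    ; trans = λ p≈q q≈r → coeffwise λ t → trans (coeffAt-≡ p≈q t) (coeffAt-≡ q≈r t)
    }

  +ₚ-*ₚ-isCommutativeRing : IsCommutativeRing _≈ₚ_ _+ₚ_ _*ₚ_ -ₚ_ [] 1ₚ
  +ₚ-*ₚ-isCommutativeRing = record
    { isRing = record
      { +-isAbelianGroup = record
        { isGroup = record
          { isMonoid = record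
            { isSemigroup = record
              { isMagma = record { isEquivalence = ≈ₚ-isEquivalence ; ∙-cong = +ₚ-cong }
              ; assoc   = +ₚ-assoc
              }
            ; identity = (λ p → coeffwise λ t → refl) , +ₚ-identityʳ
            }
          ; inverse = -ₚ-inverseˡ , (λ p → IsEquivalence.trans ≈ₚ-isEquivalence (+ₚ-comm p (-ₚ p)) (-ₚ-inverseˡ p))
          ; ⁻¹-cong = -ₚ-cong
          }
        ; comm = +ₚ-comm
        }
      ; *-cong     = λ {p} {p′} {q} {q′} p≈p′ q≈q′ → *ₚ-cong p≈p′ q≈q′
      ; *-assoc    = *ₚ-assoc
      ; *-identity = *ₚ-identityˡ , λ p → IsEquivalence.trans ≈ₚ-isEquivalence (*ₚ-comm p 1ₚ) (*ₚ-identityˡ p)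
      ; distrib    = *ₚ-distribˡ , *ₚ-distribʳ
      }
    ; *-comm = *ₚ-comm
    }
    where
    *ₚ-cong : ∀ {p p′ q q′} → p ≈ₚ p′ → q ≈ₚ q′ → p *ₚ q ≈ₚ p′ *ₚ q′
    *ₚ-cong {p} {p′} {q} {q′} p≈p′ q≈q′ = coeffwise λ t →
      trans (coeffAt-≡ (*ₚ-comm p q) t) (trans (coeffAt-≡ (*ₚ-congˡ q p≈p′) t)
      (trans (coeffAt-≡ (*ₚ-comm q p′) t) (coeffAt-≡ (*ₚ-congˡ p′ q≈q′) t)))

  polyRing : CommutativeRing _ _
  polyRing = record { isCommutativeRing = +ₚ-*ₚ-isCommutativeRing }

  constP-homomorphism : CommutativeRing.rawRing ℤP.+-*-commutativeRing -Raw-AlmostCommutative⟶ fromCommutativeRing polyRing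
  constP-homomorphism = record
    { ⟦_⟧    = constP
    ; +-homo = λ a b → coeffwise (constP-+ a b)
    ; *-homo = λ a b → coeffwise λ t → refl
    ; -‿homo = λ a → coeffwise λ t → refl
    ; 0-homo = coeffwise constP-0
    ; 1-homo = coeffwise λ t → refl
    }
    where
    constP-+ : ∀ a b t → coeffAt (constP (a ℤ.+ b)) t ≡ coeffAt (constP a +ₚ constP b) t
    constP-+ a b t with does ((0 , 0 , 0 , 0) ≋? t)
    ... | true  = trans (ℤP.+-identityʳ (a ℤ.+ b)) (cong (ℤ._+_ a) (sym (ℤP.+-identityʳ b)))
    ... | false = refl
    constP-0 : ∀ t → coeffAt (constP (+ 0)) t ≡ + 0
    constP-0 t with does ((0 , 0 , 0 , 0) ≋? t)
    ... | true  = refl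
    ... | false = refl

  constP≈? : ∀ a b → Maybe (constP a ≈ₚ constP b)
  constP≈? a b with a ℤ.≟ b
  ... | yes refl = just (coeffwise λ t → refl)
  ... | no _     = nothing

  module PolySolver = Algebra.Solver.Ring _ _ constP-homomorphism constP≈?

-- Words over ℤ₄: types, dot products and double counting

open ℕΣ
open Tally (Fin._≟_ {4})

length-filter-∑ : ∀ {P : A → Set} (P? : ∀ x → Dec (P x)) xs → length (filter P? xs) ≡ ∑[ x ∈ xs ] 𝟙 (P? x)
length-filter-∑ P? []       = refl
length-filter-∑ P? (x ∷ xs) with does (P? x)
... | true  = cong suc (length-filter-∑ P? xs)
... | false = length-filter-∑ P? xs

∑-allVecs-∷ : ∀ n (f : Vec ℤ₄ (suc n) → ℕ) →
  ∑[ w ∈ allVecs (suc n) ] f w ≡ ∑[ a ∈ List.allFin 4 ] ∑[ w ∈ allVecs n ] f (a ∷ w)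
∑-allVecs-∷ n f = trans (∑-concatMap (λ a → map (a ∷_) (allVecs n)) (List.allFin 4) f)
                        (∑-cong (List.allFin 4) (λ a → ∑-map (a ∷_) (allVecs n) f))

∑-swapAt : ∀ i n (f : Vec ℤ₄ n → ℕ) → ∑[ w ∈ allVecs n ] f (swapAt i w) ≡ ∑[ w ∈ allVecs n ] f w
∑-swapAt zero    zero          f = refl
∑-swapAt zero    (suc zero)    f = refl
∑-swapAt zero    (suc (suc n)) f = begin
  ∑[ w ∈ allVecs (suc (suc n)) ] f (swapAt zero w)
    ≡⟨ trans (∑-allVecs-∷ (suc n) _) (∑-cong (List.allFin 4) (λ a → ∑-allVecs-∷ n (λ w → f (swapAt zero (a ∷ w))))) ⟩
  ∑[ a ∈ List.allFin 4 ] ∑[ b ∈ List.allFin 4 ] ∑[ w ∈ allVecs n ] f (b ∷ a ∷ w)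
    ≡⟨ ∑-comm (List.allFin 4) (List.allFin 4) (λ a b → ∑[ w ∈ allVecs n ] f (b ∷ a ∷ w)) ⟩
  ∑[ b ∈ List.allFin 4 ] ∑[ a ∈ List.allFin 4 ] ∑[ w ∈ allVecs n ] f (b ∷ a ∷ w)
    ≡⟨ trans (∑-allVecs-∷ (suc n) f) (∑-cong (List.allFin 4) (λ b → ∑-allVecs-∷ n (λ w → f (b ∷ w)))) ⟨
  ∑[ w ∈ allVecs (suc (suc n)) ] f w
    ∎
  where open ≡-Reasoning
∑-swapAt (suc i) zero    f = refl
∑-swapAt (suc i) (suc n) f =
  trans (∑-allVecs-∷ n _) (trans (∑-cong (List.allFin 4) (λ a → ∑-swapAt i n (f ∘ (a ∷_)))) (sym (∑-allVecs-∷ n f)))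

typeOf : Vec ℤ₄ n → Mono
typeOf w = tally 0F w , tally 1F w , tally 2F w , tally 3F w

𝕖 : ℤ₄ → Mono
𝕖 k = typeOf (k ∷ [])

typeOf-∷ : ∀ k (w : Vec ℤ₄ n) → typeOf (k ∷ w) ≡ mulMono (𝕖 k) (typeOf w)
typeOf-∷ 0F w = refl
typeOf-∷ 1F w = refl
typeOf-∷ 2F w = refl
typeOf-∷ 3F w = refl

∼⇒typeOf≡ : ∀ {u v : Vec ℤ₄ n} → u ∼ v → typeOf u ≡ typeOf v
∼⇒typeOf≡ u∼v = cong₂ _,_ (tally-≡ u∼v 0F) (cong₂ _,_ (tally-≡ u∼v 1F) (cong₂ _,_ (tally-≡ u∼v 2F) (tally-≡ u∼v 3F)))

typeOf≋⇒∼ : ∀ {u v : Vec ℤ₄ n} → typeOf u ≋ typeOf v → u ∼ v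
typeOf≋⇒∼ (e₀ , e₁ , e₂ , e₃) = sameTally λ { 0F → e₀ ; 1F → e₁ ; 2F → e₂ ; 3F → e₃ }

typeOf-swapAt : ∀ i (w : Vec ℤ₄ n) → typeOf (swapAt i w) ≡ typeOf w
typeOf-swapAt i w = ∼⇒typeOf≡ (swapAt-∼ i w)

dotSum : Vec ℤ₄ n → Vec ℤ₄ n → ℕ
dotSum b v = Vec.foldr _ _+_ 0 (Vec.zipWith (λ a c → toℕ a * toℕ c) b v)

dotSum-swapAt : ∀ i (b v : Vec ℤ₄ n) → dotSum b (swapAt i v) ≡ dotSum (swapAt i b) v
dotSum-swapAt zero    []               []               = refl
dotSum-swapAt zero    (b₀ ∷ [])        (v₀ ∷ [])        = refl
dotSum-swapAt zero    (b₀ ∷ b₁ ∷ b)    (v₀ ∷ v₁ ∷ v)    =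
  x+[y+z]≡y+[x+z] (toℕ b₀ * toℕ v₁) (toℕ b₁ * toℕ v₀) (dotSum b v)
dotSum-swapAt (suc i) []               []               = refl
dotSum-swapAt (suc i) (b₀ ∷ b)         (v₀ ∷ v)         = cong (_+_ (toℕ b₀ * toℕ v₀)) (dotSum-swapAt i b v)

dotSum-comm : ∀ (b v : Vec ℤ₄ n) → dotSum b v ≡ dotSum v b
dotSum-comm []       []       = refl
dotSum-comm (b₀ ∷ b) (v₀ ∷ v) = cong₂ _+_ (ℕP.*-comm (toℕ b₀) (toℕ v₀)) (dotSum-comm b v)

typeSum : ∀ n → Mono → (Vec ℤ₄ n → ℕ) → ℕ
typeSum n t g = ∑[ w ∈ allVecs n ] (𝟙 (typeOf w ≋? t) * g w)

classSize : ℕ → Mono → ℕ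
classSize n t = typeSum n t (λ _ → 1)

dotCount : Mono → ℕ → Vec ℤ₄ n → ℕ
dotCount {n} t c v = typeSum n t (λ w → 𝟙 (dot w v ≟ c))

S0card≡dotCount : ∀ r s (v : Vec ℤ₄ n) → S0card r s v ≡ dotCount (r , s , r , s) 0 v
S0card≡dotCount {n} r s v = trans (length-filter-∑ _ (allVecs n)) (∑-cong (allVecs n) λ w →
  trans (cong (λ b → if b then 1 else 0) (does-⇔ reassociate
    (tally 0F w ≟ r ×-dec tally 1F w ≟ s ×-dec tally 2F w ≟ r ×-dec tally 3F w ≟ s ×-dec dot w v ≟ 0)
    (typeOf w ≋? (r , s , r , s) ×-dec dot w v ≟ 0)))
        (𝟙-×-dec (typeOf w ≋? (r , s , r , s)) (dot w v ≟ 0)))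
  where
  reassociate : ∀ {A B C D E : Set} → (A × B × C × D × E) ⇔ ((A × B × C × D) × E)
  reassociate = mk⇔ (λ (a , b , c , d , e) → (a , b , c , d) , e) (λ ((a , b , c , d) , e) → a , b , c , d , e)

dotCount-swapAt : ∀ t c → SwapInvariant (dotCount {n} t c)
dotCount-swapAt {n} t c i v = trans
  (∑-cong (allVecs n) λ w → cong₂ (λ m d → 𝟙 (m ≋? t) * 𝟙 (d % 4 ≟ c)) (sym (typeOf-swapAt i w)) (dotSum-swapAt i w v))
  (∑-swapAt i n (λ w → 𝟙 (typeOf w ≋? t) * 𝟙 (dot w v ≟ c)))

typeSum-class : (f : Vec ℤ₄ n → ℕ) → (∀ {u v} → u ∼ v → f u ≡ f v) → ∀ u →
                typeSum n (typeOf u) f ≡ classSize n (typeOf u) * f u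
typeSum-class {n} f f-∼ u = trans (∑-cong (allVecs n) on-class) (∑-distribʳ-* (allVecs n) (f u) (λ w → 𝟙 (typeOf w ≋? typeOf u) * 1))
  where
  on-class : ∀ w → 𝟙 (typeOf w ≋? typeOf u) * f w ≡ 𝟙 (typeOf w ≋? typeOf u) * 1 * f u
  on-class w = trans (𝟙-*-cong (typeOf w ≋? typeOf u) (f-∼ ∘ typeOf≋⇒∼))
                     (cong (_* f u) (sym (ℕP.*-identityʳ (𝟙 (typeOf w ≋? typeOf u)))))

-- Both sides count the pairs (v′, w) with type v′ = type v, type w = type b and w · v′ = c.
dotCount-double-counting : ∀ c (v b : Vec ℤ₄ n) →
  classSize n (typeOf v) * dotCount (typeOf b) c v ≡ classSize n (typeOf b) * dotCount (typeOf v) c b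
dotCount-double-counting {n} c v b = begin
  classSize n (typeOf v) * dotCount (typeOf b) c v
    ≡⟨ typeSum-class (dotCount (typeOf b) c) (∼⇒≡ _ (dotCount-swapAt (typeOf b) c)) v ⟨
  typeSum n (typeOf v) (dotCount (typeOf b) c)
    ≡⟨ ∑-cong (allVecs n) (λ v′ → ∑-distribˡ-* (allVecs n) (like-v v′) (λ w → like-b w * ⟨ w , v′ ⟩)) ⟨
  ∑[ v′ ∈ allVecs n ] ∑[ w ∈ allVecs n ] (like-v v′ * (like-b w * ⟨ w , v′ ⟩))
    ≡⟨ ∑-comm (allVecs n) (allVecs n) (λ v′ w → like-v v′ * (like-b w * ⟨ w , v′ ⟩)) ⟩
  ∑[ w ∈ allVecs n ] ∑[ v′ ∈ allVecs n ] (like-v v′ * (like-b w * ⟨ w , v′ ⟩))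
    ≡⟨ ∑-cong (allVecs n) (λ w → ∑-cong (allVecs n) (λ v′ → exchange w v′)) ⟩
  ∑[ w ∈ allVecs n ] ∑[ v′ ∈ allVecs n ] (like-b w * (like-v v′ * ⟨ v′ , w ⟩))
    ≡⟨ ∑-cong (allVecs n) (λ w → ∑-distribˡ-* (allVecs n) (like-b w) (λ v′ → like-v v′ * ⟨ v′ , w ⟩)) ⟩
  typeSum n (typeOf b) (dotCount (typeOf v) c)
    ≡⟨ typeSum-class (dotCount (typeOf v) c) (∼⇒≡ _ (dotCount-swapAt (typeOf v) c)) b ⟩
  classSize n (typeOf b) * dotCount (typeOf v) c b
    ∎
  where
  open ≡-Reasoning
  like-v like-b : Vec ℤ₄ n → ℕ
  like-v v′ = 𝟙 (typeOf v′ ≋? typeOf v)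
  like-b w  = 𝟙 (typeOf w ≋? typeOf b)
  ⟨_,_⟩ : Vec ℤ₄ n → Vec ℤ₄ n → ℕ
  ⟨ w , v′ ⟩ = 𝟙 (dot w v′ ≟ c)
  exchange : ∀ w v′ → like-v v′ * (like-b w * ⟨ w , v′ ⟩) ≡ like-b w * (like-v v′ * ⟨ v′ , w ⟩)
  exchange w v′ = trans (x*[y*z]≡y*[x*z] (like-v v′) (like-b w) ⟨ w , v′ ⟩)
    (cong (λ d → like-b w * (like-v v′ * 𝟙 (d % 4 ≟ c))) (dotSum-comm w v′))

typeSum-∷ : ∀ n t g → typeSum (suc n) t g ≡
  ∑[ k ∈ List.allFin 4 ] (𝟙 (𝕖 k ≤ₘ? t) * typeSum n (t ∸ₘ 𝕖 k) (g ∘ (k ∷_)))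
typeSum-∷ n t g = trans (∑-allVecs-∷ n (λ w → 𝟙 (typeOf w ≋? t) * g w)) (∑-cong (List.allFin 4) λ k →
  trans (∑-cong (allVecs n) (first-letter k))
        (∑-distribˡ-* (allVecs n) (𝟙 (𝕖 k ≤ₘ? t)) (λ w → 𝟙 (typeOf w ≋? t ∸ₘ 𝕖 k) * g (k ∷ w))))
  where
  first-letter : ∀ k w → 𝟙 (typeOf (k ∷ w) ≋? t) * g (k ∷ w) ≡
                         𝟙 (𝕖 k ≤ₘ? t) * (𝟙 (typeOf w ≋? t ∸ₘ 𝕖 k) * g (k ∷ w))
  first-letter k w = begin
    𝟙 (typeOf (k ∷ w) ≋? t) * g (k ∷ w)
      ≡⟨ cong (λ m → 𝟙 (m ≋? t) * g (k ∷ w)) (typeOf-∷ k w) ⟩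
    𝟙 (mulMono (𝕖 k) (typeOf w) ≋? t) * g (k ∷ w)
      ≡⟨ cong (λ b → (if b then 1 else 0) * g (k ∷ w)) (does-⇔ (mulMono≋⇔ (𝕖 k) (typeOf w) t)
           (mulMono (𝕖 k) (typeOf w) ≋? t) (𝕖 k ≤ₘ? t ×-dec typeOf w ≋? t ∸ₘ 𝕖 k)) ⟩
    𝟙 (𝕖 k ≤ₘ? t ×-dec typeOf w ≋? t ∸ₘ 𝕖 k) * g (k ∷ w)
      ≡⟨ cong (_* g (k ∷ w)) (𝟙-×-dec (𝕖 k ≤ₘ? t) (typeOf w ≋? t ∸ₘ 𝕖 k)) ⟩
    𝟙 (𝕖 k ≤ₘ? t) * 𝟙 (typeOf w ≋? t ∸ₘ 𝕖 k) * g (k ∷ w)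
      ≡⟨ ℕP.*-assoc (𝟙 (𝕖 k ≤ₘ? t)) _ _ ⟩
    𝟙 (𝕖 k ≤ₘ? t) * (𝟙 (typeOf w ≋? t ∸ₘ 𝕖 k) * g (k ∷ w))
      ∎
    where open ≡-Reasoning

-- The number of words of a given type is the multinomial coefficient

∏! : Mono → ℕ
∏! (a , b , c , d) = a ! * b ! * c ! * d !

degree : Mono → ℕ
degree (a , b , c , d) = a + b + c + d

component : ℤ₄ → Mono → ℕ
component 0F (a , _ , _ , _) = a
component 1F (_ , b , _ , _) = b
component 2F (_ , _ , c , _) = c
component 3F (_ , _ , _ , d) = d

degree-mulMono : ∀ m m′ → degree (mulMono m m′) ≡ degree m + degree m′
degree-mulMono (a , b , c , d) (a′ , b′ , c′ , d′) = regroup a b c d a′ b′ c′ d′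
  where
  regroup : ∀ a b c d a′ b′ c′ d′ → a + a′ + (b + b′) + (c + c′) + (d + d′) ≡ a + b + c + d + (a′ + b′ + c′ + d′)
  regroup = solve-∀

degree-𝕖 : ∀ k → degree (𝕖 k) ≡ 1
degree-𝕖 0F = refl
degree-𝕖 1F = refl
degree-𝕖 2F = refl
degree-𝕖 3F = refl

∏!-∷ : ∀ k m → ∏! (mulMono (𝕖 k) m) ≡ suc (component k m) * ∏! m
∏!-∷ 0F (a , b , c , d) = regroup a (a !) (b !) (c !) (d !)
  where
  regroup : ∀ x A B C D → suc x * A * B * C * D ≡ suc x * (A * B * C * D)
  regroup = solve-∀
∏!-∷ 1F (a , b , c , d) = regroup b (a !) (b !) (c !) (d !)
  where
  regroup : ∀ x A B C D → A * (suc x * B) * C * D ≡ suc x * (A * B * C * D)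
  regroup = solve-∀
∏!-∷ 2F (a , b , c , d) = regroup c (a !) (b !) (c !) (d !)
  where
  regroup : ∀ x A B C D → A * B * (suc x * C) * D ≡ suc x * (A * B * C * D)
  regroup = solve-∀
∏!-∷ 3F (a , b , c , d) = regroup d (a !) (b !) (c !) (d !)
  where
  regroup : ∀ x A B C D → A * B * C * (suc x * D) ≡ suc x * (A * B * C * D)
  regroup = solve-∀

private
  FactorialIdentity : ℕ → Set
  FactorialIdentity n = ∀ t → n ≡ degree t → classSize n t * ∏! t ≡ n !

  first-letter-suc : ∀ {n} → FactorialIdentity n → ∀ k m → suc n ≡ degree (mulMono (𝕖 k) m) →
                     1 * classSize n m * ∏! (mulMono (𝕖 k) m) ≡ suc (component k m) * n !
  first-letter-suc {n} IH k m e = begin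
    1 * classSize n m * ∏! (mulMono (𝕖 k) m)       ≡⟨ cong (1 * classSize n m *_) (∏!-∷ k m) ⟩
    1 * classSize n m * (suc (component k m) * ∏! m) ≡⟨ x*[y*z]≡y*[x*z] (1 * classSize n m) (suc (component k m)) (∏! m) ⟩
    suc (component k m) * (1 * classSize n m * ∏! m) ≡⟨ cong (λ z → suc (component k m) * (z * ∏! m)) (ℕP.*-identityˡ (classSize n m)) ⟩
    suc (component k m) * (classSize n m * ∏! m)     ≡⟨ cong (suc (component k m) *_) (IH m n≡|m|) ⟩
    suc (component k m) * n !                         ∎
    where
    open ≡-Reasoning
    n≡|m| : n ≡ degree m
    n≡|m| = ℕP.suc-injective (trans e (trans (degree-mulMono (𝕖 k) m) (cong (_+ degree m) (degree-𝕖 k))))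

  first-letter-term : ∀ {n} → FactorialIdentity n → ∀ t → suc n ≡ degree t → ∀ k →
    𝟙 (𝕖 k ≤ₘ? t) * classSize n (t ∸ₘ 𝕖 k) * ∏! t ≡ component k t * n !
  first-letter-term IH (zero  , b , c , d) _ 0F = refl
  first-letter-term IH (suc a , b , c , d) e 0F = first-letter-suc IH 0F (a , b , c , d) e
  first-letter-term IH (a , zero  , c , d) _ 1F = refl
  first-letter-term IH (a , suc b , c , d) e 1F = first-letter-suc IH 1F (a , b , c , d) e
  first-letter-term IH (a , b , zero  , d) _ 2F = refl
  first-letter-term IH (a , b , suc c , d) e 2F = first-letter-suc IH 2F (a , b , c , d) e
  first-letter-term IH (a , b , c , zero ) _ 3F = refl
  first-letter-term IH (a , b , c , suc d) e 3F = first-letter-suc IH 3F (a , b , c , d) e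

classSize-∏! : ∀ n → FactorialIdentity n
classSize-∏! zero    (zero  , zero  , zero  , zero ) refl = refl
classSize-∏! zero    (suc _ , _     , _     , _    ) ()
classSize-∏! zero    (zero  , suc _ , _     , _    ) ()
classSize-∏! zero    (zero  , zero  , suc _ , _    ) ()
classSize-∏! zero    (zero  , zero  , zero  , suc _) ()
classSize-∏! (suc n) t@(a , b , c , d) 1+n≡|t| = begin
  classSize (suc n) t * ∏! t
    ≡⟨ cong (_* ∏! t) (typeSum-∷ n t (λ _ → 1)) ⟩
  ∑[ k ∈ List.allFin 4 ] (𝟙 (𝕖 k ≤ₘ? t) * classSize n (t ∸ₘ 𝕖 k)) * ∏! t
    ≡⟨ ∑-distribʳ-* (List.allFin 4) (∏! t) (λ k → 𝟙 (𝕖 k ≤ₘ? t) * classSize n (t ∸ₘ 𝕖 k)) ⟨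
  ∑[ k ∈ List.allFin 4 ] (𝟙 (𝕖 k ≤ₘ? t) * classSize n (t ∸ₘ 𝕖 k) * ∏! t)
    ≡⟨ ∑-cong (List.allFin 4) (first-letter-term (classSize-∏! n) t 1+n≡|t|) ⟩
  ∑[ k ∈ List.allFin 4 ] (component k t * n !)
    ≡⟨ ∑-distribʳ-* (List.allFin 4) (n !) (λ k → component k t) ⟩
  (a + (b + (c + (d + 0)))) * n !
    ≡⟨ cong (_* n !) (trans (regroup a b c d) (sym 1+n≡|t|)) ⟩
  suc n * n !
    ∎
  where
  open ≡-Reasoning
  regroup : ∀ a b c d → a + (b + (c + (d + 0))) ≡ a + b + c + d
  regroup = solve-∀

multinomialᵀ : Mono → ℕ
multinomialᵀ (a , b , c , d) = multinomial a b c d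

multinomialᵀ≡classSize : ∀ t → multinomialᵀ t ≡ classSize (degree t) t
multinomialᵀ≡classSize t@(a , b , c , d) =
  trans (cong (λ m → (m / ∏! t) {{∏!≢0}}) (sym (classSize-∏! (degree t) t refl)))
        (m*n/n≡m (classSize (degree t) t) (∏! t) {{∏!≢0}})
  where
  ∏!≢0 : NonZero (∏! t)
  ∏!≢0 = m*n≢0 _ _ {{m*n≢0 _ _ {{m*n≢0 _ _ {{a !≢0}} {{b !≢0}}}} {{c !≢0}}}} {{d !≢0}}

degree-typeOf : ∀ (v : Vec ℤ₄ n) → degree (typeOf v) ≡ n
degree-typeOf []      = refl
degree-typeOf (k ∷ v) = begin
  degree (typeOf (k ∷ v))            ≡⟨ cong degree (typeOf-∷ k v) ⟩
  degree (mulMono (𝕖 k) (typeOf v))  ≡⟨ degree-mulMono (𝕖 k) (typeOf v) ⟩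
  degree (𝕖 k) + degree (typeOf v)   ≡⟨ cong₂ _+_ (degree-𝕖 k) (degree-typeOf v) ⟩
  suc _                              ∎
  where open ≡-Reasoning

multinomialᵀ-typeOf : ∀ (v : Vec ℤ₄ n) → multinomialᵀ (typeOf v) ≡ classSize n (typeOf v)
multinomialᵀ-typeOf v = trans (multinomialᵀ≡classSize (typeOf v)) (cong (λ m → classSize m (typeOf v)) (degree-typeOf v))

multinomial-double-counting : ∀ c (v b : Vec ℤ₄ n) →
  multinomialᵀ (typeOf v) * dotCount (typeOf b) c v ≡ multinomialᵀ (typeOf b) * dotCount (typeOf v) c b
multinomial-double-counting c v b =
  trans (cong (_* dotCount (typeOf b) c v) (multinomialᵀ-typeOf v))
        (trans (dotCount-double-counting c v b) (cong (_* dotCount (typeOf v) c b) (sym (multinomialᵀ-typeOf b))))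

S0card-double-counting : ∀ r s (v b : Vec ℤ₄ n) → typeOf b ≡ (r , s , r , s) →
  multinomialᵀ (typeOf v) * S0card r s v ≡ multinomial r s r s * dotCount (typeOf v) 0 b
S0card-double-counting r s v b type-b = begin
  multinomialᵀ (typeOf v) * S0card r s v                ≡⟨ cong (multinomialᵀ (typeOf v) *_) (S0card≡dotCount r s v) ⟩
  multinomialᵀ (typeOf v) * dotCount (r , s , r , s) 0 v ≡⟨ cong (λ t → multinomialᵀ (typeOf v) * dotCount t 0 v) (sym type-b) ⟩
  multinomialᵀ (typeOf v) * dotCount (typeOf b) 0 v     ≡⟨ multinomial-double-counting 0 v b ⟩
  multinomialᵀ (typeOf b) * dotCount (typeOf v) 0 b     ≡⟨ cong (λ t → multinomialᵀ t * dotCount (typeOf v) 0 b) type-b ⟩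
  multinomial r s r s * dotCount (typeOf v) 0 b         ∎
  where open ≡-Reasoning

-- The generating polynomials G_c(b) and their recursion in b

-- c − a in ℤ₄, with 3 standing for −1 so that no truncated subtraction occurs.
infixl 6 _⊖_
_⊖_ : ℕ → ℕ → ℕ
c ⊖ a = (c + 3 * a) % 4

[m%4+k]%4≡[m+k]%4 : ∀ m k → (m % 4 + k) % 4 ≡ (m + k) % 4
[m%4+k]%4≡[m+k]%4 m k = begin
  (m % 4 + k) % 4          ≡⟨ %-distribˡ-+ (m % 4) k 4 ⟩
  (m % 4 % 4 + k % 4) % 4  ≡⟨ cong (λ z → (z + k % 4) % 4) (m%n%n≡m%n m 4) ⟩
  (m % 4 + k % 4) % 4      ≡⟨ %-distribˡ-+ m k 4 ⟨
  (m + k) % 4              ∎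
  where open ≡-Reasoning

[m+k%4]%4≡[m+k]%4 : ∀ m k → (m + k % 4) % 4 ≡ (m + k) % 4
[m+k%4]%4≡[m+k]%4 m k = trans (cong (_% 4) (ℕP.+-comm m (k % 4))) (trans ([m%4+k]%4≡[m+k]%4 k m) (cong (_% 4) (ℕP.+-comm k m)))

[a+m]%4≡c⇔m%4≡c⊖a : ∀ a m c → c < 4 → (a + m) % 4 ≡ c ⇔ m % 4 ≡ c ⊖ a
[a+m]%4≡c⇔m%4≡c⊖a a m c c<4 = mk⇔ to from
  where
  open ≡-Reasoning
  to : (a + m) % 4 ≡ c → m % 4 ≡ c ⊖ a
  to e = begin
    m % 4                    ≡⟨ [m+kn]%n≡m%n m a 4 ⟨
    (m + a * 4) % 4          ≡⟨ cong (_% 4) (regroup a m) ⟩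
    (a + m + 3 * a) % 4      ≡⟨ [m%4+k]%4≡[m+k]%4 (a + m) (3 * a) ⟨
    ((a + m) % 4 + 3 * a) % 4 ≡⟨ cong (λ z → (z + 3 * a) % 4) e ⟩
    c ⊖ a                    ∎
    where
    regroup : ∀ a m → m + a * 4 ≡ a + m + 3 * a
    regroup = solve-∀
  from : m % 4 ≡ c ⊖ a → (a + m) % 4 ≡ c
  from e = begin
    (a + m) % 4              ≡⟨ [m+k%4]%4≡[m+k]%4 a m ⟨
    (a + m % 4) % 4          ≡⟨ cong (λ z → (a + z) % 4) e ⟩
    (a + (c ⊖ a)) % 4        ≡⟨ [m+k%4]%4≡[m+k]%4 a (c + 3 * a) ⟩
    (a + (c + 3 * a)) % 4    ≡⟨ cong (_% 4) (regroup a c) ⟩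
    (c + a * 4) % 4          ≡⟨ [m+kn]%n≡m%n c a 4 ⟩
    c % 4                    ≡⟨ m<n⇒m%n≡m c<4 ⟩
    c                        ∎
    where
    regroup : ∀ a c → a + (c + 3 * a) ≡ c + a * 4
    regroup = solve-∀

𝟙-dot-∷ : ∀ j β c (w b : Vec ℤ₄ n) → 𝟙 (dot (j ∷ w) (β ∷ b) ≟ toℕ c) ≡ 𝟙 (dot w b ≟ toℕ c ⊖ toℕ j * toℕ β)
𝟙-dot-∷ j β c w b = cong (λ b → if b then 1 else 0)
  (does-⇔ ([a+m]%4≡c⇔m%4≡c⊖a (toℕ j * toℕ β) (dotSum w b) (toℕ c) (FinP.toℕ<n c))
           (dot (j ∷ w) (β ∷ b) ≟ toℕ c) (dot w b ≟ toℕ c ⊖ toℕ j * toℕ β))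

dotCount-∷ : ∀ t β c (b : Vec ℤ₄ n) → dotCount t (toℕ c) (β ∷ b) ≡
  ∑[ j ∈ List.allFin 4 ] (𝟙 (𝕖 j ≤ₘ? t) * dotCount (t ∸ₘ 𝕖 j) (toℕ c ⊖ toℕ j * toℕ β) b)
dotCount-∷ {n} t β c b = trans (typeSum-∷ n t (λ w → 𝟙 (dot w (β ∷ b) ≟ toℕ c))) (∑-cong (List.allFin 4) λ j →
  cong (𝟙 (𝕖 j ≤ₘ? t) *_) (∑-cong (allVecs n) λ w →
    cong (𝟙 (typeOf w ≋? t ∸ₘ 𝕖 j) *_) (𝟙-dot-∷ j β c w b)))

dotPoly : Vec ℤ₄ n → ℕ → Poly
dotPoly {n} b c = map (λ w → + 𝟙 (dot w b ≟ c) , typeOf w) (allVecs n)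

+-∑ : ∀ (xs : List A) (f : A → ℕ) → + (∑[ x ∈ xs ] f x) ≡ ℤΣ.∑[ x ∈ xs ] (+ f x)
+-∑ []       f = refl
+-∑ (x ∷ xs) f = trans (ℤP.pos-+ (f x) _) (cong (λ z → + f x ℤ.+ z) (+-∑ xs f))

coeffAt-dotPoly : ∀ (b : Vec ℤ₄ n) c t → coeffAt (dotPoly b c) t ≡ + dotCount t c b
coeffAt-dotPoly {n} b c t =
  trans (ℤΣ.∑-map _ (allVecs n) (λ u → termCoeff u t))
        (trans (ℤΣ.∑-cong (allVecs n) term) (sym (+-∑ (allVecs n) (λ w → 𝟙 (typeOf w ≋? t) * 𝟙 (dot w b ≟ c)))))
  where
  term : ∀ w → termCoeff (+ 𝟙 (dot w b ≟ c) , typeOf w) t ≡ + (𝟙 (typeOf w ≋? t) * 𝟙 (dot w b ≟ c))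
  term w with does (typeOf w ≋? t)
  ... | true  = cong +_ (sym (ℕP.*-identityˡ _))
  ... | false = refl

coeffAt-constP-* : ∀ c p t → coeffAt (constP c *ₚ p) t ≡ c ℤ* coeffAt p t
coeffAt-constP-* c p t = trans (coeffAt-*-convolution (constP c) p t) (ℤP.+-identityʳ _)

𝕩 : ℤ₄ → Poly
𝕩 k = (+ 1 , 𝕖 k) ∷ []

coeffAt-𝕩-* : ∀ k p t → coeffAt (𝕩 k *ₚ p) t ≡ + (𝟙 (𝕖 k ≤ₘ? t)) ℤ.* coeffAt p (t ∸ₘ 𝕖 k)
coeffAt-𝕩-* k p t = trans (coeffAt-*-convolution (𝕩 k) p t) (trans (ℤP.+-identityʳ _) (gate (does (𝕖 k ≤ₘ? t))))
  where
  x : ℤ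
  x = coeffAt p (t ∸ₘ 𝕖 k)
  gate : ∀ b → (if b then + 1 ℤ.* x else + 0) ≡ + (if b then 1 else 0) ℤ.* x
  gate true  = refl
  gate false = sym (ℤP.*-zeroˡ x)

coeffAt-+₄ : ∀ p q r s t → coeffAt (p +ₚ q +ₚ r +ₚ s) t ≡ coeffAt p t ℤ.+ coeffAt q t ℤ.+ coeffAt r t ℤ.+ coeffAt s t
coeffAt-+₄ p q r s t = trans (coeffAt-++ (p +ₚ q +ₚ r) s t)
  (cong (ℤ._+ coeffAt s t) (trans (coeffAt-++ (p +ₚ q) r t) (cong (ℤ._+ coeffAt r t) (coeffAt-++ p q t))))

expansion : ℤ₄ → Vec ℤ₄ n → ℕ → Poly
expansion β b c = X *ₚ dotPoly b (c ⊖ 0 * toℕ β) +ₚ Y *ₚ dotPoly b (c ⊖ 1 * toℕ β) +ₚ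
                  Z *ₚ dotPoly b (c ⊖ 2 * toℕ β) +ₚ W *ₚ dotPoly b (c ⊖ 3 * toℕ β)

dotPoly-∷ : ∀ β c (b : Vec ℤ₄ n) → dotPoly (β ∷ b) (toℕ c) ≈ₚ expansion β b (toℕ c)
dotPoly-∷ β c b = coeffwise coefficient
  where
  G : ℤ₄ → Poly
  G j = dotPoly b (toℕ c ⊖ toℕ j * toℕ β)
  regroup : ∀ a b c d → a ℤ.+ (b ℤ.+ (c ℤ.+ (d ℤ.+ + 0))) ≡ a ℤ.+ b ℤ.+ c ℤ.+ d
  regroup = ℤ-solve-∀
  coefficient : ∀ t → coeffAt (dotPoly (β ∷ b) (toℕ c)) t ≡ coeffAt (expansion β b (toℕ c)) t
  coefficient t = begin
    coeffAt (dotPoly (β ∷ b) (toℕ c)) t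
      ≡⟨ coeffAt-dotPoly (β ∷ b) (toℕ c) t ⟩
    + dotCount t (toℕ c) (β ∷ b)
      ≡⟨ cong +_ (dotCount-∷ t β c b) ⟩
    + (∑[ j ∈ List.allFin 4 ] (𝟙 (𝕖 j ≤ₘ? t) * N j))
      ≡⟨ +-∑ (List.allFin 4) (λ j → 𝟙 (𝕖 j ≤ₘ? t) * N j) ⟩
    ℤΣ.∑[ j ∈ List.allFin 4 ] (+ (𝟙 (𝕖 j ≤ₘ? t) * N j))
      ≡⟨ ℤΣ.∑-cong (List.allFin 4) (λ j → sym (term j)) ⟩
    ℤΣ.∑[ j ∈ List.allFin 4 ] coeffAt (𝕩 j *ₚ G j) t
      ≡⟨ regroup (coeffAt (X *ₚ G 0F) t) (coeffAt (Y *ₚ G 1F) t) (coeffAt (Z *ₚ G 2F) t) (coeffAt (W *ₚ G 3F) t) ⟩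
    coeffAt (X *ₚ G 0F) t ℤ.+ coeffAt (Y *ₚ G 1F) t ℤ.+ coeffAt (Z *ₚ G 2F) t ℤ.+ coeffAt (W *ₚ G 3F) t
      ≡⟨ coeffAt-+₄ (X *ₚ G 0F) (Y *ₚ G 1F) (Z *ₚ G 2F) (W *ₚ G 3F) t ⟨
    coeffAt (X *ₚ G 0F +ₚ Y *ₚ G 1F +ₚ Z *ₚ G 2F +ₚ W *ₚ G 3F) t
      ∎
    where
    open ≡-Reasoning
    N : ℤ₄ → ℕ
    N j = dotCount (t ∸ₘ 𝕖 j) (toℕ c ⊖ toℕ j * toℕ β) b
    term : ∀ j → coeffAt (𝕩 j *ₚ G j) t ≡ + (𝟙 (𝕖 j ≤ₘ? t) * N j)
    term j = trans (coeffAt-𝕩-* j (G j) t)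
      (trans (cong (+ 𝟙 (𝕖 j ≤ₘ? t) ℤ.*_) (coeffAt-dotPoly b _ (t ∸ₘ 𝕖 j))) (sym (ℤP.pos-* (𝟙 (𝕖 j ≤ₘ? t)) (N j))))

-- Character sums

module P = CommutativeRing polyRing
open P using () renaming (trans to infixr 4 _⟨≈⟩_)
open PolySolver using (solve; _:+_; _:-_; _:*_; _:=_; con; :-_)

sum₀ sum₂ re₁ im₁ : (ℕ → Poly) → Poly
sum₀ g = g 0 +ₚ g 1 +ₚ g 2 +ₚ g 3
sum₂ g = g 0 -ₚ g 1 +ₚ g 2 -ₚ g 3
re₁  g = g 0 -ₚ g 2
im₁  g = g 1 -ₚ g 3

-- Σ_c χ(c) G_c(b) for the characters χ(c) = 1, (−1)ᶜ and iᶜ = re + i·im of ℤ₄.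
χ₀ χ₂ reχ₁ imχ₁ : Vec ℤ₄ n → Poly
χ₀   b = sum₀ (dotPoly b)
χ₂   b = sum₂ (dotPoly b)
reχ₁ b = re₁ (dotPoly b)
imχ₁ b = im₁ (dotPoly b)

σ α ρ ι : Poly
σ = X +ₚ Y +ₚ Z +ₚ W
α = X -ₚ Y +ₚ Z -ₚ W
ρ = X -ₚ Z
ι = Y -ₚ W

-- Σ_j χ(jβ) x_j for χ(c) = (−1)ᶜ and χ(c) = iᶜ: the factor by which prepending β multiplies
-- the corresponding character sum.
λ₂ reλ₁ imλ₁ : ℤ₄ → Poly
λ₂ 0F = σ
λ₂ 1F = α
λ₂ 2F = σ
λ₂ 3F = α
reλ₁ 0F = σ
reλ₁ 1F = ρ
reλ₁ 2F = α
reλ₁ 3F = ρ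
imλ₁ 0F = constP (+ 0)
imλ₁ 1F = ι
imλ₁ 2F = constP (+ 0)
imλ₁ 3F = -ₚ ι

module _ {g h : ℕ → Poly} (g≈h : ∀ (c : ℤ₄) → g (toℕ c) ≈ₚ h (toℕ c)) where

  sum₀-cong : sum₀ g ≈ₚ sum₀ h
  sum₀-cong = P.+-cong (P.+-cong (P.+-cong (g≈h 0F) (g≈h 1F)) (g≈h 2F)) (g≈h 3F)

  sum₂-cong : sum₂ g ≈ₚ sum₂ h
  sum₂-cong = P.+-cong (P.+-cong (P.+-cong (g≈h 0F) (P.-‿cong (g≈h 1F))) (g≈h 2F)) (P.-‿cong (g≈h 3F))

  re₁-cong : re₁ g ≈ₚ re₁ h
  re₁-cong = P.+-cong (g≈h 0F) (P.-‿cong (g≈h 2F))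

  im₁-cong : im₁ g ≈ₚ im₁ h
  im₁-cong = P.+-cong (g≈h 1F) (P.-‿cong (g≈h 3F))

-- The same expressions in the solver's syntax.  For a literal letter their semantics unfold to the
-- Poly-level terms, so each case of a multiplier below is a single solver call.
module Syntax {m : ℕ} where
  open PolySolver using (Polynomial)

  pick : Polynomial m → Polynomial m → Polynomial m → Polynomial m → ℕ → Polynomial m
  pick g₀ g₁ g₂ g₃ 0 = g₀
  pick g₀ g₁ g₂ g₃ 1 = g₁
  pick g₀ g₁ g₂ g₃ 2 = g₂
  pick g₀ g₁ g₂ g₃ _ = g₃

  expansionₛ : ℤ₄ → (x y z w : Polynomial m) → (ℕ → Polynomial m) → ℕ → Polynomial m
  expansionₛ β x y z w g c =
    x :* g (c ⊖ 0 * toℕ β) :+ y :* g (c ⊖ 1 * toℕ β) :+ z :* g (c ⊖ 2 * toℕ β) :+ w :* g (c ⊖ 3 * toℕ β)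

  σₛ αₛ ρₛ ιₛ : (x y z w : Polynomial m) → Polynomial m
  σₛ x y z w = x :+ y :+ z :+ w
  αₛ x y z w = x :- y :+ z :- w
  ρₛ x y z w = x :- z
  ιₛ x y z w = y :- w

  λ₂ₛ reλ₁ₛ imλ₁ₛ : ℤ₄ → (x y z w : Polynomial m) → Polynomial m
  λ₂ₛ 0F = σₛ
  λ₂ₛ 1F = αₛ
  λ₂ₛ 2F = σₛ
  λ₂ₛ 3F = αₛ
  reλ₁ₛ 0F = σₛ
  reλ₁ₛ 1F = ρₛ
  reλ₁ₛ 2F = αₛ
  reλ₁ₛ 3F = ρₛ
  imλ₁ₛ 0F x y z w = con (+ 0)
  imλ₁ₛ 1F x y z w = ιₛ x y z w
  imλ₁ₛ 2F x y z w = con (+ 0)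
  imλ₁ₛ 3F x y z w = :- ιₛ x y z w

  sum₀ₛ sum₂ₛ re₁ₛ im₁ₛ : (ℕ → Polynomial m) → Polynomial m
  sum₀ₛ g = g 0 :+ g 1 :+ g 2 :+ g 3
  sum₂ₛ g = g 0 :- g 1 :+ g 2 :- g 3
  re₁ₛ  g = g 0 :- g 2
  im₁ₛ  g = g 1 :- g 3

open Syntax

module _ (b : Vec ℤ₄ n) where

  private
    G : ℕ → Poly
    G = dotPoly b

    G-∷ : ∀ β (c : ℤ₄) → dotPoly (β ∷ b) (toℕ c) ≈ₚ expansion β b (toℕ c)
    G-∷ β c = dotPoly-∷ β c b

  χ₀-∷ : ∀ β → χ₀ (β ∷ b) ≈ₚ σ *ₚ χ₀ b
  χ₀-∷ β = sum₀-cong {dotPoly (β ∷ b)} {expansion β b} (G-∷ β) ⟨≈⟩ multiplier β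
    where
    multiplier : ∀ β → sum₀ (expansion β b) ≈ₚ σ *ₚ χ₀ b
    multiplier 0F = solve 8 (λ x y z w g₀ g₁ g₂ g₃ → let g = pick g₀ g₁ g₂ g₃ in
      sum₀ₛ (expansionₛ 0F x y z w g) := σₛ x y z w :* sum₀ₛ g)
      P.refl X Y Z W (G 0) (G 1) (G 2) (G 3)
    multiplier 1F = solve 8 (λ x y z w g₀ g₁ g₂ g₃ → let g = pick g₀ g₁ g₂ g₃ in
      sum₀ₛ (expansionₛ 1F x y z w g) := σₛ x y z w :* sum₀ₛ g)
      P.refl X Y Z W (G 0) (G 1) (G 2) (G 3)
    multiplier 2F = solve 8 (λ x y z w g₀ g₁ g₂ g₃ → let g = pick g₀ g₁ g₂ g₃ in
      sum₀ₛ (expansionₛ 2F x y z w g) := σₛ x y z w :* sum₀ₛ g)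
      P.refl X Y Z W (G 0) (G 1) (G 2) (G 3)
    multiplier 3F = solve 8 (λ x y z w g₀ g₁ g₂ g₃ → let g = pick g₀ g₁ g₂ g₃ in
      sum₀ₛ (expansionₛ 3F x y z w g) := σₛ x y z w :* sum₀ₛ g)
      P.refl X Y Z W (G 0) (G 1) (G 2) (G 3)

  χ₂-∷ : ∀ β → χ₂ (β ∷ b) ≈ₚ λ₂ β *ₚ χ₂ b
  χ₂-∷ β = sum₂-cong {dotPoly (β ∷ b)} {expansion β b} (G-∷ β) ⟨≈⟩ multiplier β
    where
    multiplier : ∀ β → sum₂ (expansion β b) ≈ₚ λ₂ β *ₚ χ₂ b
    multiplier 0F = solve 8 (λ x y z w g₀ g₁ g₂ g₃ → let g = pick g₀ g₁ g₂ g₃ in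
      sum₂ₛ (expansionₛ 0F x y z w g) := λ₂ₛ 0F x y z w :* sum₂ₛ g)
      P.refl X Y Z W (G 0) (G 1) (G 2) (G 3)
    multiplier 1F = solve 8 (λ x y z w g₀ g₁ g₂ g₃ → let g = pick g₀ g₁ g₂ g₃ in
      sum₂ₛ (expansionₛ 1F x y z w g) := λ₂ₛ 1F x y z w :* sum₂ₛ g)
      P.refl X Y Z W (G 0) (G 1) (G 2) (G 3)
    multiplier 2F = solve 8 (λ x y z w g₀ g₁ g₂ g₃ → let g = pick g₀ g₁ g₂ g₃ in
      sum₂ₛ (expansionₛ 2F x y z w g) := λ₂ₛ 2F x y z w :* sum₂ₛ g)
      P.refl X Y Z W (G 0) (G 1) (G 2) (G 3)
    multiplier 3F = solve 8 (λ x y z w g₀ g₁ g₂ g₃ → let g = pick g₀ g₁ g₂ g₃ in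
      sum₂ₛ (expansionₛ 3F x y z w g) := λ₂ₛ 3F x y z w :* sum₂ₛ g)
      P.refl X Y Z W (G 0) (G 1) (G 2) (G 3)

  reχ₁-∷ : ∀ β → reχ₁ (β ∷ b) ≈ₚ reλ₁ β *ₚ reχ₁ b -ₚ imλ₁ β *ₚ imχ₁ b
  reχ₁-∷ β = re₁-cong {dotPoly (β ∷ b)} {expansion β b} (G-∷ β) ⟨≈⟩ multiplier β
    where
    multiplier : ∀ β → re₁ (expansion β b) ≈ₚ reλ₁ β *ₚ reχ₁ b -ₚ imλ₁ β *ₚ imχ₁ b
    multiplier 0F = solve 8 (λ x y z w g₀ g₁ g₂ g₃ → let g = pick g₀ g₁ g₂ g₃ in
      re₁ₛ (expansionₛ 0F x y z w g) := reλ₁ₛ 0F x y z w :* re₁ₛ g :- imλ₁ₛ 0F x y z w :* im₁ₛ g)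
      P.refl X Y Z W (G 0) (G 1) (G 2) (G 3)
    multiplier 1F = solve 8 (λ x y z w g₀ g₁ g₂ g₃ → let g = pick g₀ g₁ g₂ g₃ in
      re₁ₛ (expansionₛ 1F x y z w g) := reλ₁ₛ 1F x y z w :* re₁ₛ g :- imλ₁ₛ 1F x y z w :* im₁ₛ g)
      P.refl X Y Z W (G 0) (G 1) (G 2) (G 3)
    multiplier 2F = solve 8 (λ x y z w g₀ g₁ g₂ g₃ → let g = pick g₀ g₁ g₂ g₃ in
      re₁ₛ (expansionₛ 2F x y z w g) := reλ₁ₛ 2F x y z w :* re₁ₛ g :- imλ₁ₛ 2F x y z w :* im₁ₛ g)
      P.refl X Y Z W (G 0) (G 1) (G 2) (G 3)
    multiplier 3F = solve 8 (λ x y z w g₀ g₁ g₂ g₃ → let g = pick g₀ g₁ g₂ g₃ in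
      re₁ₛ (expansionₛ 3F x y z w g) := reλ₁ₛ 3F x y z w :* re₁ₛ g :- imλ₁ₛ 3F x y z w :* im₁ₛ g)
      P.refl X Y Z W (G 0) (G 1) (G 2) (G 3)

  imχ₁-∷ : ∀ β → imχ₁ (β ∷ b) ≈ₚ reλ₁ β *ₚ imχ₁ b +ₚ imλ₁ β *ₚ reχ₁ b
  imχ₁-∷ β = im₁-cong {dotPoly (β ∷ b)} {expansion β b} (G-∷ β) ⟨≈⟩ multiplier β
    where
    multiplier : ∀ β → im₁ (expansion β b) ≈ₚ reλ₁ β *ₚ imχ₁ b +ₚ imλ₁ β *ₚ reχ₁ b
    multiplier 0F = solve 8 (λ x y z w g₀ g₁ g₂ g₃ → let g = pick g₀ g₁ g₂ g₃ in
      im₁ₛ (expansionₛ 0F x y z w g) := reλ₁ₛ 0F x y z w :* im₁ₛ g :+ imλ₁ₛ 0F x y z w :* re₁ₛ g)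
      P.refl X Y Z W (G 0) (G 1) (G 2) (G 3)
    multiplier 1F = solve 8 (λ x y z w g₀ g₁ g₂ g₃ → let g = pick g₀ g₁ g₂ g₃ in
      im₁ₛ (expansionₛ 1F x y z w g) := reλ₁ₛ 1F x y z w :* im₁ₛ g :+ imλ₁ₛ 1F x y z w :* re₁ₛ g)
      P.refl X Y Z W (G 0) (G 1) (G 2) (G 3)
    multiplier 2F = solve 8 (λ x y z w g₀ g₁ g₂ g₃ → let g = pick g₀ g₁ g₂ g₃ in
      im₁ₛ (expansionₛ 2F x y z w g) := reλ₁ₛ 2F x y z w :* im₁ₛ g :+ imλ₁ₛ 2F x y z w :* re₁ₛ g)
      P.refl X Y Z W (G 0) (G 1) (G 2) (G 3)
    multiplier 3F = solve 8 (λ x y z w g₀ g₁ g₂ g₃ → let g = pick g₀ g₁ g₂ g₃ in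
      im₁ₛ (expansionₛ 3F x y z w g) := reλ₁ₛ 3F x y z w :* im₁ₛ g :+ imλ₁ₛ 3F x y z w :* re₁ₛ g)
      P.refl X Y Z W (G 0) (G 1) (G 2) (G 3)

χ₀≈σ^n : ∀ (b : Vec ℤ₄ n) → χ₀ b ≈ₚ σ ^ₚ n
χ₀≈σ^n []      = solve 0 (con (+ 1) :+ con (+ 0) :+ con (+ 0) :+ con (+ 0) := con (+ 1)) P.refl
χ₀≈σ^n (β ∷ b) = χ₀-∷ b β ⟨≈⟩ *ₚ-congˡ σ (χ₀≈σ^n b)

-- The length is r * 2 + s * 2 rather than 2 * (r + s) because the former unfolds along the recursion.
word : (r s : ℕ) → Vec ℤ₄ (r * 2 + s * 2)
word (suc r) s       = 0F ∷ 2F ∷ word r s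
word zero    (suc s) = 1F ∷ 3F ∷ word zero s
word zero    zero    = []

word-length : ∀ r s → r * 2 + s * 2 ≡ 2 * (r + s)
word-length = solve-∀

typeOf-word : ∀ r s → typeOf (word r s) ≡ (r , s , r , s)
typeOf-word (suc r) s       = cong (λ (a , b , c , d) → suc a , b , suc c , d) (typeOf-word r s)
typeOf-word zero    (suc s) = cong (λ (a , b , c , d) → a , suc b , c , suc d) (typeOf-word zero s)
typeOf-word zero    zero    = refl

χ₂-word : ∀ r s → χ₂ (word r s) ≈ₚ σ ^ₚ (r * 2) *ₚ α ^ₚ (s * 2)
χ₂-word (suc r) s =
  χ₂-∷ (2F ∷ word r s) 0F ⟨≈⟩ *ₚ-congˡ σ (χ₂-∷ (word r s) 2F ⟨≈⟩ *ₚ-congˡ σ (χ₂-word r s)) ⟨≈⟩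
  solve 3 (λ S P Q → S :* (S :* (P :* Q)) := S :* (S :* P) :* Q) P.refl σ (σ ^ₚ (r * 2)) (α ^ₚ (s * 2))
χ₂-word zero (suc s) =
  χ₂-∷ (3F ∷ word zero s) 1F ⟨≈⟩ *ₚ-congˡ α (χ₂-∷ (word zero s) 3F ⟨≈⟩ *ₚ-congˡ α (χ₂-word zero s)) ⟨≈⟩
  solve 2 (λ A Q → A :* (A :* (con (+ 1) :* Q)) := con (+ 1) :* (A :* (A :* Q))) P.refl α (α ^ₚ (s * 2))
χ₂-word zero zero =
  solve 0 (con (+ 1) :- con (+ 0) :+ con (+ 0) :- con (+ 0) := con (+ 1) :* con (+ 1)) P.refl

pair₀₂ pair₁₃ : Poly
pair₀₂ = (X +ₚ Z) ^ₚ 2 -ₚ (Y +ₚ W) ^ₚ 2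
pair₁₃ = (X -ₚ Z) ^ₚ 2 +ₚ (Y -ₚ W) ^ₚ 2

reχ₁-0∷2∷ : ∀ (b : Vec ℤ₄ n) → reχ₁ (0F ∷ 2F ∷ b) ≈ₚ pair₀₂ *ₚ reχ₁ b
reχ₁-0∷2∷ b =
  reχ₁-∷ (2F ∷ b) 0F ⟨≈⟩ P.+-cong (*ₚ-congˡ σ (reχ₁-∷ b 2F)) P.refl ⟨≈⟩
  solve 7 (λ x y z w re im im′ →
    σₛ x y z w :* (αₛ x y z w :* re :- con (+ 0) :* im) :- con (+ 0) :* im′
    := ((x :+ z) :* ((x :+ z) :* con (+ 1)) :- (y :+ w) :* ((y :+ w) :* con (+ 1))) :* re)
  P.refl X Y Z W (reχ₁ b) (imχ₁ b) (imχ₁ (2F ∷ b))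

-- (ρ + iι)(ρ − iι) = ρ² + ι² is real, so the imaginary part cancels.
reχ₁-1∷3∷ : ∀ (b : Vec ℤ₄ n) → reχ₁ (1F ∷ 3F ∷ b) ≈ₚ pair₁₃ *ₚ reχ₁ b
reχ₁-1∷3∷ b =
  reχ₁-∷ (3F ∷ b) 1F ⟨≈⟩ P.+-cong (*ₚ-congˡ ρ (reχ₁-∷ b 3F)) (P.-‿cong (*ₚ-congˡ ι (imχ₁-∷ b 3F))) ⟨≈⟩
  solve 6 (λ x y z w re im →
    ρₛ x y z w :* (ρₛ x y z w :* re :- (:- ιₛ x y z w) :* im) :- ιₛ x y z w :* (ρₛ x y z w :* im :+ (:- ιₛ x y z w) :* re)
    := ((x :- z) :* ((x :- z) :* con (+ 1)) :+ (y :- w) :* ((y :- w) :* con (+ 1))) :* re)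
  P.refl X Y Z W (reχ₁ b) (imχ₁ b)

reχ₁-word : ∀ r s → reχ₁ (word r s) ≈ₚ pair₀₂ ^ₚ r *ₚ pair₁₃ ^ₚ s
reχ₁-word (suc r) s =
  reχ₁-0∷2∷ (word r s) ⟨≈⟩ *ₚ-congˡ pair₀₂ (reχ₁-word r s) ⟨≈⟩
  P.sym (P.*-assoc pair₀₂ (pair₀₂ ^ₚ r) (pair₁₃ ^ₚ s))
reχ₁-word zero (suc s) =
  reχ₁-1∷3∷ (word zero s) ⟨≈⟩ *ₚ-congˡ pair₁₃ (reχ₁-word zero s) ⟨≈⟩
  solve 2 (λ B Q → B :* (con (+ 1) :* Q) := con (+ 1) :* (B :* Q)) P.refl pair₁₃ (pair₁₃ ^ₚ s)
reχ₁-word zero zero =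
  solve 0 (con (+ 1) :- con (+ 0) := con (+ 1) :* con (+ 1)) P.refl

dotPoly≈χ : ∀ (b : Vec ℤ₄ n) → constP (+ 4) *ₚ dotPoly b 0 ≈ₚ χ₀ b +ₚ constP (+ 2) *ₚ reχ₁ b +ₚ χ₂ b
dotPoly≈χ b = solve 4 (λ g₀ g₁ g₂ g₃ → let g = pick g₀ g₁ g₂ g₃ in
  con (+ 4) :* g₀ := sum₀ₛ g :+ con (+ 2) :* re₁ₛ g :+ sum₂ₛ g)
  P.refl (dotPoly b 0) (dotPoly b 1) (dotPoly b 2) (dotPoly b 3)

reference-word : ∀ r s → r * 2 + s * 2 ≡ n →
  Σ (Vec ℤ₄ n) λ b → typeOf b ≡ (r , s , r , s) × constP (+ 4) *ₚ dotPoly b 0 ≈ₚ F r s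
reference-word r s refl = word r s , typeOf-word r s ,
  dotPoly≈χ (word r s) ⟨≈⟩
  P.+-cong (P.+-cong (χ₀≈σ^n (word r s) ⟨≈⟩ P.reflexive (cong (σ ^ₚ_) (word-length r s)))
                     (*ₚ-congˡ (constP (+ 2)) (reχ₁-word r s) ⟨≈⟩
                      P.sym (P.*-assoc (constP (+ 2)) (pair₀₂ ^ₚ r) (pair₁₃ ^ₚ s))))
           (χ₂-word r s ⟨≈⟩ P.reflexive (cong₂ (λ a c → σ ^ₚ a *ₚ α ^ₚ c) (ℕP.*-comm r 2) (ℕP.*-comm s 2)))

coeff-F : ∀ r s (b : Vec ℤ₄ n) → constP (+ 4) *ₚ dotPoly b 0 ≈ₚ F r s → ∀ t₀ t₁ t₂ t₃ →
          coeff (F r s) t₀ t₁ t₂ t₃ ≡ + (4 * dotCount (t₀ , t₁ , t₂ , t₃) 0 b)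
coeff-F r s b 4G≈F t₀ t₁ t₂ t₃ = begin
  coeff (F r s) t₀ t₁ t₂ t₃                ≡⟨ coeff≡coeffAt (F r s) t₀ t₁ t₂ t₃ ⟩
  coeffAt (F r s) t                         ≡⟨ coeffAt-≡ 4G≈F t ⟨
  coeffAt (constP (+ 4) *ₚ dotPoly b 0) t   ≡⟨ coeffAt-constP-* (+ 4) (dotPoly b 0) t ⟩
  + 4 ℤ* coeffAt (dotPoly b 0) t            ≡⟨ cong (+ 4 ℤ*_) (coeffAt-dotPoly b 0 t) ⟩
  + 4 ℤ* + dotCount t 0 b                   ≡⟨ ℤP.pos-* 4 (dotCount t 0 b) ⟨
  + (4 * dotCount t 0 b)                    ∎
  where
  open ≡-Reasoning
  t = t₀ , t₁ , t₂ , t₃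

-- The identity holds for r = s = 0 as well.
lemma6 : (r s : ℕ) → 1 ≤ r + s → (v : Vec ℤ₄ (2 * (r + s))) →
    (+ (4 * multinomial (tcount zero v) (tcount (suc zero) v) (tcount (suc (suc zero)) v) (tcount (suc (suc (suc zero))) v)
    * S0card r s v))
    ≡ (+ multinomial r s r s) ℤ* coeff (F r s) (tcount zero v) (tcount (suc zero) v) (tcount (suc (suc zero)) v) (tcount (suc (suc (suc zero))) v)
lemma6 r s _ v with reference-word r s (word-length r s)
... | b , type-b , 4G≈F = begin
  + (4 * multinomialᵀ (typeOf v) * S0card r s v)
    ≡⟨ cong +_ (trans (ℕP.*-assoc 4 (multinomialᵀ (typeOf v)) (S0card r s v)) (cong (4 *_) (S0card-double-counting r s v b type-b))) ⟩
  + (4 * (multinomial r s r s * dotCount (typeOf v) 0 b))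
    ≡⟨ cong +_ (x*[y*z]≡y*[x*z] 4 (multinomial r s r s) (dotCount (typeOf v) 0 b)) ⟩
  + (multinomial r s r s * (4 * dotCount (typeOf v) 0 b))
    ≡⟨ ℤP.pos-* (multinomial r s r s) (4 * dotCount (typeOf v) 0 b) ⟩
  + multinomial r s r s ℤ* + (4 * dotCount (typeOf v) 0 b)
    ≡⟨ cong (+ multinomial r s r s ℤ*_) (coeff-F r s b 4G≈F _ _ _ _) ⟨
  + multinomial r s r s ℤ* coeff (F r s) (tcount 0F v) (tcount 1F v) (tcount 2F v) (tcount 3F v)
    ∎
  where open ≡-Reasoning
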